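{- Let $n\ge 3$ be a prime and let $G$ be the graph defined in the context below. Then: (1) for each $k,l\in[n]$, the set $P^l_k=\{v^l_{k,1},\dots,v^l_{k,n}\}$ is an independent set of $G^2$; (2) for each $i\in[n-1]$, the sets $Q_i=\{w_{i,1},\dots,w_{i,n}\}$ and $R_i=\{u_{i,1},\dots,u_{i,n}\}$ are independent sets of $G^2$; (3) the set $S=\{s_1,\dots,s_n\}$ is an independent set of $G^2$.
   Context: For a graph $H$, $H^2$ denotes the square of $H$: the graph on $V(H)$ in which two distinct vertices are adjacent iff their distance in $H$ is at most $2$. Write $[n]=\{1,\dots,n\}$. For $i\in[n-1]$ define $L_i(j,k)\in[n]$ for $j,k\in[n]$ by $L_i(j,k)\equiv j+i(k-1)\pmod n$ (the residue $0$ being represented by $n$). The graph $G$ has vertex set consisting of: vertices $v^l_{k,j}$ for $k,l,j\in[n]$; vertices $w_{i,j}$ and $u_{i,j}$ for $i\in[n-1]$, $j\in[n]$; and vertices $s_m$ for $m\in[n]$ (all distinct). For $l,m\in[n]$ let $T_{l,m}=\{v^l_{1,m},v^l_{2,m},\dots,v^l_{n,m}\}$. The edges of $G$ are exactly: - $w_{i,j}v^l_{k,L_i(j,k)}$ for all $i\in[n-1]$, $j,k,l\in[n]$; - $u_{i,j}y$ for all $i\in[n-1]$, $j\in[n]$ and all $y\in T_{l,L_i(j,l)}$ for some $l\in[n]$; - $s_m y$ for all $m\in[n]$ and all $y\in T_{l,m}$ for some $l\in[n]$. -}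

module Defs where

open import Data.Nat using (ℕ; zero; suc; _+_; _*_; _∸_)
open import Data.Nat.DivMod using (_mod_)
open import Data.Fin using (Fin; toℕ)
open import Data.Product using (Σ; _×_; ∃-syntax)
open import Data.Sum using (_⊎_)
open import Relation.Binary.PropositionalEquality using (_≡_; _≢_)
open import Relation.Nullary using (¬_)

-- Convention: [n] is represented by Fin n, the element a : Fin n standing
-- for the number toℕ a + 1.  Likewise [n-1] is Fin (n ∸ 1), a standing for
-- toℕ a + 1.

-- L i j k : with i = i'+1, j = j'+1, k = k'+1 we have
-- L_i(j,k) ≡ j + i(k-1) (mod n), represented in [n] with 0 ↦ n;
-- its Fin-representative (value minus one) is (j' + (i'+1) k') mod n.
L : (n : ℕ) → Fin (n ∸ 1) → Fin n → Fin n → Fin n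
L zero i () k
L (suc m) i j k = (toℕ j + suc (toℕ i) * toℕ k) mod (suc m)

data V (n : ℕ) : Set where
  v : (l k j : Fin n) → V n
  w : (i : Fin (n ∸ 1)) (j : Fin n) → V n
  u : (i : Fin (n ∸ 1)) (j : Fin n) → V n
  s : (m : Fin n) → V n

-- The listed edges (oriented as written in the paper).
-- Note T_{l,m} = { v^l_{k,m} : k ∈ [n] }.
data E (n : ℕ) : V n → V n → Set where
  wv : ∀ i j k l → E n (w i j) (v l k (L n i j k))
  uv : ∀ i j l k → E n (u i j) (v l k (L n i j l))
  sv : ∀ m l k → E n (s m) (v l k m)

Adj : (n : ℕ) → V n → V n → Set
Adj n x y = E n x y ⊎ E n y x

Adj² : (n : ℕ) → V n → V n → Set
Adj² n x y = x ≢ y × (Adj n x y ⊎ ∃[ z ] (Adj n x z × Adj n z y))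

IndependentSet : {A : Set} → (A → A → Set) → (A → Set) → Set
IndependentSet R S = ∀ x y → S x → S y → ¬ R x y

P : (n : ℕ) → (l k : Fin n) → V n → Set
P n l k x = ∃[ j ] (x ≡ v l k j)

Q : (n : ℕ) → Fin (n ∸ 1) → V n → Set
Q n i x = ∃[ j ] (x ≡ w i j)

R : (n : ℕ) → Fin (n ∸ 1) → V n → Set
R n i x = ∃[ j ] (x ≡ u i j)

S : (n : ℕ) → V n → Set
S n x = ∃[ m ] (x ≡ s m)

module Submission where

-- G is bipartite, with the v-vertices on one side and the w-, u- and s-vertices
-- on the other, and each of P, Q, R, S lies on one side.  So two of its members
-- are never adjacent in G, and it suffices that a common neighbour determines
-- the member.  A w-, u- or s-vertex has exactly one neighbour in each row
-- {v^l_{k,j} : j ∈ [n]}; a vertex v^l_{k,m} is adjacent to w_{i,j} only for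
-- m = L_i(j,k), to u_{i,j} only for m = L_i(j,l), and to s_j only for m = j,
-- and j ↦ L_i(j,k) is injective since it is a translation modulo n.

open import Defs
open import Data.Nat using (ℕ; _≤_; _∸_; suc; _+_; _*_; _%_; _/_; NonZero)
open import Data.Nat.Primality using (Prime)
open import Data.Nat.Properties using (+-assoc; +-comm; m+[n∸m]≡n)
open import Data.Nat.DivMod
  using (_mod_; %-distribˡ-+; m%n%n≡m%n; [m+kn]%n≡m%n; m≡m%n+[m/n]*n; m%n≤n; m%n<n; m<n⇒m%n≡m)
open import Data.Fin using (Fin; toℕ)
open import Data.Fin.Properties using (toℕ-injective; toℕ<n; toℕ-fromℕ<)
open import Data.Product using (_×_; _,_; ∃-syntax)
open import Data.Sum using (inj₁; inj₂; swap)
open import Relation.Binary.PropositionalEquality using (_≡_; _≢_; refl; sym; trans; cong; module ≡-Reasoning)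

[m%n+k]%n≡[m+k]%n : ∀ m k n .{{_ : NonZero n}} → (m % n + k) % n ≡ (m + k) % n
[m%n+k]%n≡[m+k]%n m k n = begin
  (m % n + k) % n           ≡⟨ %-distribˡ-+ (m % n) k n ⟩
  (m % n % n + k % n) % n   ≡⟨ cong (λ x → (x + k % n) % n) (m%n%n≡m%n m n) ⟩
  (m % n + k % n) % n       ≡⟨ %-distribˡ-+ m k n ⟨
  (m + k) % n               ∎
  where open ≡-Reasoning

m+[n∸m%n]≡[1+m/n]*n : ∀ m n .{{_ : NonZero n}} → m + (n ∸ m % n) ≡ suc (m / n) * n
m+[n∸m%n]≡[1+m/n]*n m n = begin
  m + r′                        ≡⟨ cong (_+ r′) (m≡m%n+[m/n]*n m n) ⟩
  m % n + m / n * n + r′        ≡⟨ +-assoc (m % n) (m / n * n) r′ ⟩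
  m % n + (m / n * n + r′)      ≡⟨ cong (m % n +_) (+-comm (m / n * n) r′) ⟩
  m % n + (r′ + m / n * n)      ≡⟨ +-assoc (m % n) r′ (m / n * n) ⟨
  m % n + r′ + m / n * n        ≡⟨ cong (_+ m / n * n) (m+[n∸m]≡n (m%n≤n m n)) ⟩
  n + m / n * n                 ∎
  where
  open ≡-Reasoning
  r′ : ℕ
  r′ = n ∸ m % n

%-cancelʳ-+ : ∀ a b c n .{{_ : NonZero n}} → (a + c) % n ≡ (b + c) % n → a % n ≡ b % n
%-cancelʳ-+ a b c n eq = begin
  a % n                    ≡⟨ undo a ⟨
  ((a + c) % n + c′) % n   ≡⟨ cong (λ x → (x + c′) % n) eq ⟩
  ((b + c) % n + c′) % n   ≡⟨ undo b ⟩
  b % n                    ∎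
  where
  open ≡-Reasoning
  c′ : ℕ
  c′ = n ∸ c % n
  undo : ∀ x → ((x + c) % n + c′) % n ≡ x % n
  undo x = begin
    ((x + c) % n + c′) % n   ≡⟨ [m%n+k]%n≡[m+k]%n (x + c) c′ n ⟩
    (x + c + c′) % n         ≡⟨ cong (_% n) (+-assoc x c c′) ⟩
    (x + (c + c′)) % n       ≡⟨ cong (λ y → (x + y) % n) (m+[n∸m%n]≡[1+m/n]*n c n) ⟩
    (x + suc (c / n) * n) % n ≡⟨ [m+kn]%n≡m%n x (suc (c / n)) n ⟩
    x % n                    ∎

toℕ-mod : ∀ m n .{{_ : NonZero n}} → toℕ (m mod n) ≡ m % n
toℕ-mod m n = toℕ-fromℕ< (m%n<n m n)

+-mod-injective : ∀ {n} .{{_ : NonZero n}} c {a b : Fin n} →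
  (toℕ a + c) mod n ≡ (toℕ b + c) mod n → a ≡ b
+-mod-injective {n} c {a} {b} eq = toℕ-injective (begin
  toℕ a       ≡⟨ m<n⇒m%n≡m (toℕ<n a) ⟨
  toℕ a % n   ≡⟨ %-cancelʳ-+ (toℕ a) (toℕ b) c n (trans (sym (toℕ-mod (toℕ a + c) n))
                   (trans (cong toℕ eq) (toℕ-mod (toℕ b + c) n))) ⟩
  toℕ b % n   ≡⟨ m<n⇒m%n≡m (toℕ<n b) ⟩
  toℕ b       ∎)
  where open ≡-Reasoning

L-injective : ∀ {n} i k {j j′ : Fin n} → L n i j k ≡ L n i j′ k → j ≡ j′
L-injective {suc _} i k = +-mod-injective (suc (toℕ i) * toℕ k)

data Side : Set where
  source target : Side

side : ∀ {n} → V n → Side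
side (v _ _ _) = target
side (w _ _)   = source
side (u _ _)   = source
side (s _)     = source

Adj-crosses-sides : ∀ {n x y} → Adj n x y → side x ≢ side y
Adj-crosses-sides (inj₁ (wv _ _ _ _)) ()
Adj-crosses-sides (inj₁ (uv _ _ _ _)) ()
Adj-crosses-sides (inj₁ (sv _ _ _))   ()
Adj-crosses-sides (inj₂ (wv _ _ _ _)) ()
Adj-crosses-sides (inj₂ (uv _ _ _ _)) ()
Adj-crosses-sides (inj₂ (sv _ _ _))   ()

image-independent-in-square : ∀ {n} {A : Set} (f : A → V n) →
  (∀ a b → side (f a) ≡ side (f b)) →
  (∀ {z a b} → Adj n z (f a) → Adj n z (f b) → a ≡ b) →
  IndependentSet (Adj² n) (λ x → ∃[ a ] x ≡ f a)
image-independent-in-square f one-sided determined _ _ (a , refl) (b , refl) (_ , inj₁ adj) =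
  Adj-crosses-sides adj (one-sided a b)
image-independent-in-square f one-sided determined _ _ (a , refl) (b , refl) (fa≢fb , inj₂ (_ , az , zb)) =
  fa≢fb (cong f (determined (swap az) zb))

row-neighbour-unique : ∀ {n z l k j j′} → Adj n z (v l k j) → Adj n z (v l k j′) → j ≡ j′
row-neighbour-unique (inj₁ (wv _ _ _ _)) (inj₁ (wv _ _ _ _)) = refl
row-neighbour-unique (inj₁ (uv _ _ _ _)) (inj₁ (uv _ _ _ _)) = refl
row-neighbour-unique (inj₁ (sv _ _ _))   (inj₁ (sv _ _ _))   = refl
row-neighbour-unique (inj₂ ()) _
row-neighbour-unique _ (inj₂ ())

w-neighbour-index : ∀ {n i j l k m} → E n (w i j) (v l k m) → m ≡ L n i j k
w-neighbour-index (wv _ _ _ _) = refl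

u-neighbour-index : ∀ {n i j l k m} → E n (u i j) (v l k m) → m ≡ L n i j l
u-neighbour-index (uv _ _ _ _) = refl

w-common-neighbour : ∀ {n z i j j′} → Adj n z (w i j) → Adj n z (w i j′) → j ≡ j′
w-common-neighbour (inj₁ ()) _
w-common-neighbour _ (inj₁ ())
w-common-neighbour (inj₂ (wv i _ k _)) (inj₂ e) = L-injective i k (w-neighbour-index e)

u-common-neighbour : ∀ {n z i j j′} → Adj n z (u i j) → Adj n z (u i j′) → j ≡ j′
u-common-neighbour (inj₁ ()) _
u-common-neighbour _ (inj₁ ())
u-common-neighbour (inj₂ (uv i _ l _)) (inj₂ e) = L-injective i l (u-neighbour-index e)

s-common-neighbour : ∀ {n z m m′} → Adj n z (s m) → Adj n z (s m′) → m ≡ m′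
s-common-neighbour (inj₁ ()) _
s-common-neighbour _ (inj₁ ())
s-common-neighbour (inj₂ (sv _ _ _)) (inj₂ (sv _ _ _)) = refl

lemma2p3 : (n : ℕ) → Prime n → 3 ≤ n →
    ((l k : Fin n) → IndependentSet (Adj² n) (P n l k))
    × ((i : Fin (n ∸ 1)) → IndependentSet (Adj² n) (Q n i) × IndependentSet (Adj² n) (R n i))
    × IndependentSet (Adj² n) (S n)
lemma2p3 n _ _ =
    (λ l k → image-independent-in-square (v l k) (λ _ _ → refl) row-neighbour-unique)
  , (λ i → image-independent-in-square (w i) (λ _ _ → refl) w-common-neighbour
         , image-independent-in-square (u i) (λ _ _ → refl) u-common-neighbour)
  , image-independent-in-square s (λ _ _ → refl) s-common-neighbour
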